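{- For any graphs $G$ and $H$ with no isolated vertex, $$\max\{\rho(G)\gamma_{R}(H), \rho(H)\gamma_{R}(G)\}\leq \gamma_{R}(G\times H)\leq \min\{2\gamma(G)\gamma_{tR}(H), 2\gamma(H)\gamma_{tR}(G)\}.$$
   Context: All graphs are finite and simple; $N(v)$ is the open and $N[v]=N(v)\cup\{v\}$ the closed neighborhood of $v$. The direct product $G\times H$ has vertex set $V(G)\times V(H)$, with $(u,v)$ adjacent to $(u',v')$ iff $uu'\in E(G)$ and $vv'\in E(H)$. A set $S\subseteq V(G)$ is dominating if every vertex is in $S$ or adjacent to a vertex of $S$; $\gamma(G)$ is the minimum size of a dominating set. A packing is a set $A\subseteq V(G)$ such that $N[x]\cap N[y]=\emptyset$ for all distinct $x,y\in A$; $\rho(G)$ is the maximum size of a packing. For $f:V(G)\to\{0,1,2\}$ write $V_i=\{v: f(v)=i\}$ and $\omega(f)=|V_1|+2|V_2|$. $f$ is a Roman dominating function (RDF) if every vertex in $V_0$ has a neighbor in $V_2$; $\gamma_R(G)$ is the minimum weight of an RDF. An RDF is a total Roman dominating function (TRDF) if the subgraph induced by $V_1\cup V_2$ has no isolated vertices; $\gamma_{tR}(G)$ is the minimum weight of a TRDF. -}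

module Defs where

open import Data.Nat using (ℕ; _≤_; _≥_; _*_)
open import Data.Fin using (Fin; remQuot)
open import Data.Fin.Subset using (Subset; _∈_; ∣_∣)
open import Data.List using (map; allFin)
open import Data.Nat.ListAction using (sum)
open import Data.Product using (Σ; ∃; _×_; _,_; proj₁; proj₂)
open import Data.Sum using (_⊎_)
open import Relation.Nullary using (¬_)
open import Relation.Binary.PropositionalEquality using (_≡_; _≢_)

record Graph : Set₁ where
  field
    n      : ℕ
    Adj    : Fin n → Fin n → Set
    sym    : ∀ {u v} → Adj u v → Adj v u
    irrefl : ∀ {u} → ¬ Adj u u
open Graph public

NoIsolated : Graph → Set
NoIsolated G = ∀ v → ∃ λ u → Adj G v u

-- Direct product G × H on vertex set Fin (n G * n H), identified with
-- Fin (n G) × Fin (n H) via remQuot.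
_⊠_ : Graph → Graph → Graph
G ⊠ H = record
  { n = n G * n H
  ; Adj = λ i j → Adj G (proj₁ (rq i)) (proj₁ (rq j))
                × Adj H (proj₂ (rq i)) (proj₂ (rq j))
  ; sym = λ { (a , b) → sym G a , sym H b }
  ; irrefl = λ { (a , _) → irrefl G a }
  }
  where
  rq : Fin (n G * n H) → Fin (n G) × Fin (n H)
  rq = remQuot {n G} (n H)

InClosedNbhd : (G : Graph) → Fin (n G) → Fin (n G) → Set
InClosedNbhd G x z = z ≡ x ⊎ Adj G x z

IsDominating : (G : Graph) → Subset (n G) → Set
IsDominating G S = ∀ v → v ∈ S ⊎ (∃ λ u → u ∈ S × Adj G v u)

IsPacking : (G : Graph) → Subset (n G) → Set
IsPacking G A = ∀ x y → x ∈ A → y ∈ A → x ≢ y →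
  ¬ (∃ λ z → InClosedNbhd G x z × InClosedNbhd G y z)

-- functions V(G) → {0,1,2} represented as ℕ-valued functions bounded by 2
weight : (G : Graph) → (Fin (n G) → ℕ) → ℕ
weight G f = sum (map f (allFin (n G)))

IsRDF : (G : Graph) → (Fin (n G) → ℕ) → Set
IsRDF G f = (∀ v → f v ≤ 2) × (∀ v → f v ≡ 0 → ∃ λ u → Adj G v u × f u ≡ 2)

-- total: the subgraph induced by V₁ ∪ V₂ has no isolated vertices
IsTRDF : (G : Graph) → (Fin (n G) → ℕ) → Set
IsTRDF G f = IsRDF G f × (∀ v → f v ≥ 1 → ∃ λ u → Adj G v u × f u ≥ 1)

IsMin : {A : Set} → (A → Set) → (A → ℕ) → ℕ → Set
IsMin P size k = (∃ λ x → P x × size x ≡ k) × (∀ x → P x → k ≤ size x)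

IsMax : {A : Set} → (A → Set) → (A → ℕ) → ℕ → Set
IsMax P size k = (∃ λ x → P x × size x ≡ k) × (∀ x → P x → size x ≤ k)

IsDominationNumber : Graph → ℕ → Set
IsDominationNumber G = IsMin (IsDominating G) ∣_∣

IsPackingNumber : Graph → ℕ → Set
IsPackingNumber G = IsMax (IsPacking G) ∣_∣

IsRomanDominationNumber : Graph → ℕ → Set
IsRomanDominationNumber G = IsMin (IsRDF G) (weight G)

IsTotalRomanDominationNumber : Graph → ℕ → Set
IsTotalRomanDominationNumber G = IsMin (IsTRDF G) (weight G)

-- Lower bound: let h be a Roman dominating function of G × H and A a packing of G.
-- For x ∈ A, b ↦ min(2, Σ_{a ∈ N[x]} h(a,b)) is a Roman dominating function of H, since
-- a zero at (x,b) is dominated from some (a',b') with a' ∈ N(x); so its weight is at least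
-- γR(H). The closed neighbourhoods of a packing are disjoint, so these weights add up to
-- at most w(h).
-- Upper bound: given a dominating set D of G and a total Roman dominating function f of H,
-- let every x ∈ D, with a chosen neighbour x', put 2 on {x} × (V₁ ∪ V₂) and on {x'} × V₂.
-- A vertex (a,b) outside D is dominated through a neighbour x ∈ D of a and a neighbour of b
-- in V₁ ∪ V₂ (totality); for a ∈ D and f(b) = 0 one uses x' and a neighbour of b in V₂.
-- The weight is at most 2|D|(|V₁| + 2|V₂|) = 2|D| w(f).
-- Both bounds are symmetric in G and H.
module Submission where

open import Defs hiding (sym)
open import Data.Nat.Properties
open import Algebra.Properties.Semiring.Sum +-*-semiring
  using (sum; ∑-comm; ∑-distrib-+; *-distribˡ-sum; *-distribʳ-sum; sum-cong-≗)
open import Data.Bool using (if_then_else_)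
open import Data.Fin using (Fin; zero; suc; _↑ˡ_; _↑ʳ_; combine; remQuot)
  renaming (_≟_ to _≟ᶠ_)
open import Data.Fin.Properties using (remQuot-combine; combine-remQuot; any?)
  renaming (suc-injective to suc-injectiveᶠ; 0≢1+n to 0≢1+nᶠ)
open import Data.Fin.Subset using (Subset; _∈_; ∣_∣; inside; outside)
open import Data.Fin.Subset.Properties using (_∈?_)
open import Data.List using (map; tabulate)
open import Data.Nat using (ℕ; zero; suc; _≤_; _*_; _+_; _⊔_; _⊓_; z≤n; s≤s; _≤?_; _≟_)
open import Data.Nat.ListAction as List using ()
open import Data.Product using (_×_; _,_; proj₁; proj₂; ∃; ∃₂; uncurry)
open import Data.Sum using (_⊎_; inj₁; inj₂)
open import Data.Vec using ([]; _∷_)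
open import Function using (_∘_; id; flip)
open import Level using (0ℓ)
open import Relation.Binary.PropositionalEquality
open import Relation.Nullary using (Dec; does; yes; no; ¬_; contradiction)
open import Relation.Nullary.Decidable using (dec-true; dec-false; _×-dec_; _⊎-dec_)
open import Relation.Unary using (Pred; Decidable)

𝟙 : {P : Set} → Dec P → ℕ
𝟙 d = if does d then 1 else 0

𝟙*≡ : {P : Set} (d : Dec P) → P → ∀ m → 𝟙 d * m ≡ m
𝟙*≡ d p m rewrite dec-true d p = +-identityʳ m

𝟙-×-dec : {P Q : Set} (p : Dec P) (q : Dec Q) → 𝟙 (p ×-dec q) ≡ 𝟙 p * 𝟙 q
𝟙-×-dec (yes _) (yes _) = refl
𝟙-×-dec (yes _) (no _)  = refl
𝟙-×-dec (no _)  _       = refl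

∑-mono : ∀ {n} {f g : Fin n → ℕ} → (∀ i → f i ≤ g i) → sum f ≤ sum g
∑-mono {zero}  _   = z≤n
∑-mono {suc n} f≤g = +-mono-≤ (f≤g zero) (∑-mono (f≤g ∘ suc))

term≤∑ : ∀ {n} (f : Fin n → ℕ) i → f i ≤ sum f
term≤∑ f zero    = m≤m+n _ _
term≤∑ f (suc i) = ≤-trans (term≤∑ (f ∘ suc) i) (m≤n+m _ (f zero))

∑-𝟙-empty : ∀ {n} {P : Pred (Fin n) 0ℓ} (P? : Decidable P) → (∀ i → ¬ P i) →
  sum (𝟙 ∘ P?) ≡ 0
∑-𝟙-empty {zero}  P? ¬P = refl
∑-𝟙-empty {suc n} P? ¬P rewrite dec-false (P? zero) (¬P zero) =
  ∑-𝟙-empty (P? ∘ suc) (¬P ∘ suc)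

∑-𝟙-unique≤1 : ∀ {n} {P : Pred (Fin n) 0ℓ} (P? : Decidable P) →
  (∀ {i j} → P i → P j → i ≡ j) → sum (𝟙 ∘ P?) ≤ 1
∑-𝟙-unique≤1 {zero}  P? unique = z≤n
∑-𝟙-unique≤1 {suc n} P? unique with P? zero
... | yes p = ≤-reflexive (cong suc (∑-𝟙-empty (P? ∘ suc) (λ i q → 0≢1+nᶠ (unique p q))))
... | no _  = ∑-𝟙-unique≤1 (P? ∘ suc) (λ p q → suc-injectiveᶠ (unique p q))

∑-𝟙≟-*≤ : ∀ {n} (x : Fin n) c → sum (λ a → 𝟙 (a ≟ᶠ x) * c) ≤ c
∑-𝟙≟-*≤ x c = begin
  sum (λ a → 𝟙 (a ≟ᶠ x) * c)  ≡⟨ *-distribʳ-sum c (λ a → 𝟙 (a ≟ᶠ x)) ⟨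
  sum (λ a → 𝟙 (a ≟ᶠ x)) * c  ≤⟨ *-monoˡ-≤ c (∑-𝟙-unique≤1 (_≟ᶠ x) λ p q → trans p (sym q)) ⟩
  1 * c                       ≡⟨ *-identityˡ c ⟩
  c                           ∎
  where open ≤-Reasoning

∣p∣≡∑𝟙∈ : ∀ {n} (p : Subset n) → ∣ p ∣ ≡ sum (λ x → 𝟙 (x ∈? p))
∣p∣≡∑𝟙∈ []            = refl
∣p∣≡∑𝟙∈ (inside ∷ p)  = cong suc (∣p∣≡∑𝟙∈ p)
∣p∣≡∑𝟙∈ (outside ∷ p) = ∣p∣≡∑𝟙∈ p

∑-𝟙∈-* : ∀ {n} (p : Subset n) c → sum (λ x → 𝟙 (x ∈? p) * c) ≡ ∣ p ∣ * c
∑-𝟙∈-* p c = begin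
  sum (λ x → 𝟙 (x ∈? p) * c)  ≡⟨ *-distribʳ-sum c (λ x → 𝟙 (x ∈? p)) ⟨
  sum (λ x → 𝟙 (x ∈? p)) * c  ≡⟨ cong (_* c) (∣p∣≡∑𝟙∈ p) ⟨
  ∣ p ∣ * c                    ∎
  where open ≡-Reasoning

∑-disjoint : ∀ {k m} {A : Pred (Fin k) 0ℓ} {T : Fin k → Pred (Fin m) 0ℓ}
  (A? : Decidable A) (T? : ∀ x → Decidable (T x)) (u : Fin m → ℕ) →
  (∀ {a x y} → A x × T x a → A y × T y a → x ≡ y) →
  sum (λ x → 𝟙 (A? x) * sum (λ a → 𝟙 (T? x a) * u a)) ≤ sum u
∑-disjoint A? T? u disjoint = begin
  sum (λ x → 𝟙 (A? x) * sum (λ a → 𝟙 (T? x a) * u a))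
    ≡⟨ sum-cong-≗ (λ x → *-distribˡ-sum (𝟙 (A? x)) (λ a → 𝟙 (T? x a) * u a)) ⟩
  sum (λ x → sum (λ a → 𝟙 (A? x) * (𝟙 (T? x a) * u a)))
    ≡⟨ ∑-comm (λ x a → 𝟙 (A? x) * (𝟙 (T? x a) * u a)) ⟩
  sum (λ a → sum (λ x → 𝟙 (A? x) * (𝟙 (T? x a) * u a)))
    ≡⟨ sum-cong-≗ (λ a → sum-cong-≗ (regroup a)) ⟩
  sum (λ a → sum (λ x → 𝟙 (A? x ×-dec T? x a) * u a))
    ≡⟨ sum-cong-≗ (λ a → *-distribʳ-sum (u a) (λ x → 𝟙 (A? x ×-dec T? x a))) ⟨
  sum (λ a → sum (λ x → 𝟙 (A? x ×-dec T? x a)) * u a)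
    ≤⟨ ∑-mono (λ a → *-monoˡ-≤ (u a) (∑-𝟙-unique≤1 (λ x → A? x ×-dec T? x a) disjoint)) ⟩
  sum (λ a → 1 * u a)
    ≡⟨ sum-cong-≗ (λ a → *-identityˡ (u a)) ⟩
  sum u ∎
  where
  open ≤-Reasoning
  regroup : ∀ a x → 𝟙 (A? x) * (𝟙 (T? x a) * u a) ≡ 𝟙 (A? x ×-dec T? x a) * u a
  regroup a x = trans (sym (*-assoc (𝟙 (A? x)) (𝟙 (T? x a)) (u a)))
                      (cong (_* u a) (sym (𝟙-×-dec (A? x) (T? x a))))

∑-↑ : ∀ m {n} (f : Fin (m + n) → ℕ) → sum f ≡ sum (f ∘ (_↑ˡ n)) + sum (f ∘ (m ↑ʳ_))
∑-↑ zero    f = refl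
∑-↑ (suc m) f = trans (cong (f zero +_) (∑-↑ m (f ∘ suc))) (sym (+-assoc (f zero) _ _))

∑-combine : ∀ m {n} (f : Fin (m * n) → ℕ) →
  sum f ≡ sum (λ a → sum (λ b → f (combine {m} {n} a b)))
∑-combine zero        f = refl
∑-combine (suc m) {n} f =
  trans (∑-↑ n {m * n} f)
        (cong (sum (λ b → f (b ↑ˡ (m * n))) +_) (∑-combine m (f ∘ (n ↑ʳ_))))

weight≡sum : (G : Graph) (f : Fin (n G) → ℕ) → weight G f ≡ sum f
weight≡sum G f = sum-map-tabulate id
  where
  sum-map-tabulate : ∀ {k} (g : Fin k → Fin (n G)) → List.sum (map f (tabulate g)) ≡ sum (f ∘ g)
  sum-map-tabulate {zero}  g = refl
  sum-map-tabulate {suc k} g = cong (f (g zero) +_) (sum-map-tabulate (g ∘ suc))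

2⊓n≡0⇒n≡0 : ∀ n → 2 ⊓ n ≡ 0 → n ≡ 0
2⊓n≡0⇒n≡0 zero _ = refl

∑∑ : ∀ {k m} → (Fin k → Fin m → ℕ) → ℕ
∑∑ h = sum (λ a → sum (h a))

∑∑-flip : ∀ {k m} (h : Fin k → Fin m → ℕ) → ∑∑ (flip h) ≡ ∑∑ h
∑∑-flip h = sym (∑-comm h)

record IsProductRDF (G H : Graph) (h : Fin (n G) → Fin (n H) → ℕ) : Set where
  constructor isProductRDF
  field
    bounded   : ∀ a b → h a b ≤ 2
    dominated : ∀ a b → h a b ≡ 0 → ∃₂ λ a' b' → Adj G a a' × Adj H b b' × h a' b' ≡ 2

IsProductRDF-flip : ∀ {G H h} → IsProductRDF G H h → IsProductRDF H G (flip h)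
IsProductRDF-flip (isProductRDF h≤2 dominated) = isProductRDF (flip h≤2) λ b a h≡0 →
  let (a' , b' , aa' , bb' , h≡2) = dominated a b h≡0 in b' , a' , bb' , aa' , h≡2

weight-⊠ : (G H : Graph) (g : Fin (n (G ⊠ H)) → ℕ) →
  weight (G ⊠ H) g ≡ ∑∑ (λ a b → g (combine {n G} {n H} a b))
weight-⊠ G H g = trans (weight≡sum (G ⊠ H) g) (∑-combine (n G) {n H} g)

IsRDF⇒IsProductRDF : ∀ {G H g} → IsRDF (G ⊠ H) g →
  IsProductRDF G H (λ a b → g (combine {n G} {n H} a b))
IsRDF⇒IsProductRDF {G} {H} {g} (g≤2 , dominated) = isProductRDF (λ a b → g≤2 _) λ a b g≡0 →
  let (u , (au , bu) , gu≡2) = dominated (combine a b) g≡0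
      (a' , b') = remQuot {n G} (n H) u
      ab≡ = remQuot-combine {n G} {n H} a b
  in a' , b' , subst (λ p → Adj G (proj₁ p) a') ab≡ au , subst (λ p → Adj H (proj₂ p) b') ab≡ bu ,
     trans (cong g (combine-remQuot {n G} (n H) u)) gu≡2

IsProductRDF⇒IsRDF : ∀ {G H h} → IsProductRDF G H h →
  IsRDF (G ⊠ H) (uncurry h ∘ remQuot {n G} (n H))
IsProductRDF⇒IsRDF {G} {H} {h} (isProductRDF h≤2 dominated) = (λ i → h≤2 _ _) , λ i h≡0 →
  let (a' , b' , aa' , bb' , h≡2) = dominated _ _ h≡0
      ab≡ = sym (remQuot-combine {n G} {n H} a' b')
  in combine a' b' , (subst (Adj G _ ∘ proj₁) ab≡ aa' , subst (Adj H _ ∘ proj₂) ab≡ bb') ,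
     subst (λ p → uncurry h p ≡ 2) ab≡ h≡2

γR⊠-attained : ∀ G H {γ} → IsRomanDominationNumber (G ⊠ H) γ →
  ∃ λ h → IsProductRDF G H h × ∑∑ h ≡ γ
γR⊠-attained G H ((g , g-rdf , wg≡γ) , _) =
  _ , IsRDF⇒IsProductRDF {G} {H} g-rdf , trans (sym (weight-⊠ G H g)) wg≡γ

γR⊠≤∑∑ : ∀ G H {γ h} → IsRomanDominationNumber (G ⊠ H) γ → IsProductRDF G H h → γ ≤ ∑∑ h
γR⊠≤∑∑ G H {γ} {h} (_ , minimal) h-rdf = begin
  γ                                         ≤⟨ minimal g (IsProductRDF⇒IsRDF {G} {H} h-rdf) ⟩
  weight (G ⊠ H) g                          ≡⟨ weight-⊠ G H g ⟩
  ∑∑ (λ a b → g (combine {n G} {n H} a b))  ≡⟨ sum-cong-≗ (λ a → sum-cong-≗ (g∘combine≗h a)) ⟩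
  ∑∑ h                                      ∎
  where
  open ≤-Reasoning
  g : Fin (n (G ⊠ H)) → ℕ
  g = uncurry h ∘ remQuot {n G} (n H)
  g∘combine≗h : ∀ a b → g (combine a b) ≡ h a b
  g∘combine≗h a b = cong (uncurry h) (remQuot-combine a b)

module _ {G H : Graph} {h : Fin (n G) → Fin (n H) → ℕ} (h-rdf : IsProductRDF G H h) where

  private
    dominated = IsProductRDF.dominated h-rdf

  dominatorRow : Fin (n G) → Fin (n H) → Fin (n G)
  dominatorRow x b with h x b ≟ 0
  ... | yes h≡0 = proj₁ (dominated x b h≡0)
  ... | no _    = x

  dominatorRow∈N[x] : ∀ x b → InClosedNbhd G x (dominatorRow x b)
  dominatorRow∈N[x] x b with h x b ≟ 0
  ... | yes h≡0 = inj₂ (proj₁ (proj₂ (proj₂ (dominated x b h≡0))))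
  ... | no _    = inj₁ refl

  dominatorRow-dominates : ∀ x b → h x b ≡ 0 → ∃ λ b' → Adj H b b' × h (dominatorRow x b) b' ≡ 2
  dominatorRow-dominates x b h≡0 with h x b ≟ 0
  ... | yes h≡0' = let (_ , b' , _ , bb' , h≡2) = dominated x b h≡0' in b' , bb' , h≡2
  ... | no h≢0   = contradiction h≡0 h≢0

  -- Adjacency is not decidable, so instead of N[x] the projection at x uses the rows it
  -- needs: x and the rows of the dominators of its zeros. They still lie in N[x].
  ChargedTo : Fin (n G) → Pred (Fin (n G)) 0ℓ
  ChargedTo x a = a ≡ x ⊎ ∃ λ b → a ≡ dominatorRow x b

  chargedTo? : ∀ x → Decidable (ChargedTo x)
  chargedTo? x a = (a ≟ᶠ x) ⊎-dec any? (λ b → a ≟ᶠ dominatorRow x b)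

  chargedTo⊆N[x] : ∀ {x a} → ChargedTo x a → InClosedNbhd G x a
  chargedTo⊆N[x]     (inj₁ a≡x)      = inj₁ a≡x
  chargedTo⊆N[x] {x} (inj₂ (b , refl)) = dominatorRow∈N[x] x b

  projection : Fin (n G) → Fin (n H) → ℕ
  projection x b = 2 ⊓ sum (λ a → 𝟙 (chargedTo? x a) * h a b)

  projection-isRDF : ∀ x → IsRDF H (projection x)
  projection-isRDF x = (λ b → m⊓n≤m 2 _) , λ b projection≡0 →
    let (b' , bb' , h≡2) = dominatorRow-dominates x b (h≡0 b projection≡0)
        2≡term = sym (charged-term (inj₂ (b , refl)) h≡2)
    in b' , bb' , m≤n⇒m⊓n≡m (≤-trans (≤-reflexive 2≡term) (term≤∑ _ (dominatorRow x b)))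
    where
    charged-term : ∀ {a b k} → ChargedTo x a → h a b ≡ k → 𝟙 (chargedTo? x a) * h a b ≡ k
    charged-term {a} {b} charged refl = 𝟙*≡ (chargedTo? x a) charged (h a b)

    h≡0 : ∀ b → projection x b ≡ 0 → h x b ≡ 0
    h≡0 b projection≡0 = n≤0⇒n≡0 (begin
      h x b                                          ≡⟨ charged-term (inj₁ refl) refl ⟨
      𝟙 (chargedTo? x x) * h x b                     ≤⟨ term≤∑ _ x ⟩
      sum (λ a → 𝟙 (chargedTo? x a) * h a b)          ≡⟨ 2⊓n≡0⇒n≡0 _ projection≡0 ⟩
      0                                              ∎)
      where open ≤-Reasoning

  weight-projection : ∀ x → weight H (projection x) ≤ sum (λ a → 𝟙 (chargedTo? x a) * sum (h a))
  weight-projection x = begin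
    weight H (projection x)        ≡⟨ weight≡sum H (projection x) ⟩
    sum (projection x)             ≤⟨ ∑-mono (λ b → m⊓n≤n 2 (sum (λ a → c a b))) ⟩
    sum (λ b → sum (λ a → c a b))  ≡⟨ ∑-comm (flip c) ⟩
    sum (λ a → sum (λ b → c a b))  ≡⟨ sum-cong-≗ (λ a → *-distribˡ-sum (𝟙 (chargedTo? x a)) (h a)) ⟨
    sum (λ a → 𝟙 (chargedTo? x a) * sum (h a)) ∎
    where
    open ≤-Reasoning
    c : Fin (n G) → Fin (n H) → ℕ
    c a b = 𝟙 (chargedTo? x a) * h a b

  chargedTo-disjoint : ∀ {A} → IsPacking G A →
    ∀ {a x y} → x ∈ A × ChargedTo x a → y ∈ A × ChargedTo y a → x ≡ y
  chargedTo-disjoint packing {a} {x} {y} (x∈A , ax) (y∈A , ay) with x ≟ᶠ y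
  ... | yes x≡y = x≡y
  ... | no x≢y  = contradiction (a , chargedTo⊆N[x] ax , chargedTo⊆N[x] ay) (packing x y x∈A y∈A x≢y)

  ρ*γR≤∑∑ : ∀ {ρ γ} → IsPackingNumber G ρ → IsRomanDominationNumber H γ → ρ * γ ≤ ∑∑ h
  ρ*γR≤∑∑ {ρ} {γ} ((A , packing , ∣A∣≡ρ) , _) (_ , minimal) = begin
    ρ * γ
      ≡⟨ cong (_* γ) ∣A∣≡ρ ⟨
    ∣ A ∣ * γ
      ≡⟨ ∑-𝟙∈-* A γ ⟨
    sum (λ x → 𝟙 (x ∈? A) * γ)
      ≤⟨ ∑-mono (λ x → *-monoʳ-≤ (𝟙 (x ∈? A)) (γ≤charged x)) ⟩
    sum (λ x → 𝟙 (x ∈? A) * sum (λ a → 𝟙 (chargedTo? x a) * sum (h a)))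
      ≤⟨ ∑-disjoint (_∈? A) chargedTo? (sum ∘ h) (chargedTo-disjoint packing) ⟩
    ∑∑ h ∎
    where
    open ≤-Reasoning
    γ≤charged : ∀ x → γ ≤ sum (λ a → 𝟙 (chargedTo? x a) * sum (h a))
    γ≤charged x = ≤-trans (minimal _ (projection-isRDF x)) (weight-projection x)

positiveNeighbour : ∀ {H f} → IsTRDF H f → ∀ b → ∃ λ b' → Adj H b b' × 1 ≤ f b'
positiveNeighbour {f = f} ((_ , dominated) , total) b with f b ≟ 0
... | yes f≡0 = let (b' , bb' , f≡2) = dominated b f≡0 in b' , bb' , subst (1 ≤_) (sym f≡2) (s≤s z≤n)
... | no f≢0  = total b (n≢0⇒n>0 f≢0)

2*𝟙[1≤k]+2*𝟙[k≡2]≤2*k : ∀ k → k ≤ 2 → 2 * 𝟙 (1 ≤? k) + 2 * 𝟙 (k ≟ 2) ≤ 2 * k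
2*𝟙[1≤k]+2*𝟙[k≡2]≤2*k 0 _ = ≤-refl
2*𝟙[1≤k]+2*𝟙[k≡2]≤2*k 1 _ = ≤-refl
2*𝟙[1≤k]+2*𝟙[k≡2]≤2*k 2 _ = ≤-refl
2*𝟙[1≤k]+2*𝟙[k≡2]≤2*k (suc (suc (suc _))) (s≤s (s≤s ()))

module DominationLabel {G H : Graph} (noIsolated : NoIsolated G)
  {D : Subset (n G)} (dominating : IsDominating G D)
  {f : Fin (n H) → ℕ} (trdf : IsTRDF H f) where

  partner : Fin (n G) → Fin (n G)
  partner x = proj₁ (noIsolated x)

  contribution : Fin (n G) → Fin (n G) → Fin (n H) → ℕ
  contribution x a b = 𝟙 (a ≟ᶠ x) * (2 * 𝟙 (1 ≤? f b)) + 𝟙 (a ≟ᶠ partner x) * (2 * 𝟙 (f b ≟ 2))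

  label : Fin (n G) → Fin (n H) → ℕ
  label a b = 2 ⊓ sum (λ x → 𝟙 (x ∈? D) * contribution x a b)

  label≡2 : ∀ {x a b} → x ∈ D → 2 ≤ contribution x a b → label a b ≡ 2
  label≡2 {x} {a} {b} x∈D 2≤c = m≤n⇒m⊓n≡m (begin
    2                                   ≤⟨ 2≤c ⟩
    contribution x a b                  ≡⟨ 𝟙*≡ (x ∈? D) x∈D _ ⟨
    𝟙 (x ∈? D) * contribution x a b     ≤⟨ term≤∑ (λ y → 𝟙 (y ∈? D) * contribution y a b) x ⟩
    sum (λ y → 𝟙 (y ∈? D) * contribution y a b) ∎)
    where open ≤-Reasoning

  label-own : ∀ {x b} → x ∈ D → 1 ≤ f b → label x b ≡ 2
  label-own {x} {b} x∈D 1≤f = label≡2 {x} {x} {b} x∈D (≤-trans (≤-reflexive own) (m≤m+n _ _))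
    where
    own : 2 ≡ 𝟙 (x ≟ᶠ x) * (2 * 𝟙 (1 ≤? f b))
    own rewrite dec-true (x ≟ᶠ x) refl | dec-true (1 ≤? f b) 1≤f = refl

  label-partner : ∀ {x b} → x ∈ D → f b ≡ 2 → label (partner x) b ≡ 2
  label-partner {x} {b} x∈D f≡2 =
    label≡2 {x} {partner x} {b} x∈D (≤-trans (≤-reflexive shared) (m≤n+m _ _))
    where
    shared : 2 ≡ 𝟙 (partner x ≟ᶠ partner x) * (2 * 𝟙 (f b ≟ 2))
    shared rewrite dec-true (partner x ≟ᶠ partner x) refl | dec-true (f b ≟ 2) f≡2 = refl

  label-isProductRDF : IsProductRDF G H label
  label-isProductRDF = isProductRDF (λ a b → m⊓n≤m 2 _) dominated
    where
    dominated : ∀ a b → label a b ≡ 0 → ∃₂ λ a' b' → Adj G a a' × Adj H b b' × label a' b' ≡ 2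
    dominated a b label≡0 with dominating a
    ... | inj₂ (x , x∈D , ax) =
      let (b' , bb' , 1≤f) = positiveNeighbour {H} trdf b in x , b' , ax , bb' , label-own x∈D 1≤f
    ... | inj₁ a∈D with f b ≟ 0
    ...   | no f≢0  = contradiction (trans (sym label≡0) (label-own a∈D (n≢0⇒n>0 f≢0))) λ ()
    ...   | yes f≡0 = let (b' , bb' , f≡2) = proj₂ (proj₁ trdf) b f≡0
                      in partner a , b' , proj₂ (noIsolated a) , bb' , label-partner a∈D f≡2

  contribution-cost : ∀ x b → sum (λ a → contribution x a b) ≤ 2 * f b
  contribution-cost x b = begin
    sum (λ a → contribution x a b)
      ≡⟨ ∑-distrib-+ (λ a → 𝟙 (a ≟ᶠ x) * e₁) (λ a → 𝟙 (a ≟ᶠ partner x) * e₂) ⟩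
    sum (λ a → 𝟙 (a ≟ᶠ x) * e₁) + sum (λ a → 𝟙 (a ≟ᶠ partner x) * e₂)
      ≤⟨ +-mono-≤ (∑-𝟙≟-*≤ x e₁) (∑-𝟙≟-*≤ (partner x) e₂) ⟩
    e₁ + e₂
      ≤⟨ 2*𝟙[1≤k]+2*𝟙[k≡2]≤2*k (f b) (proj₁ (proj₁ trdf) b) ⟩
    2 * f b ∎
    where
    open ≤-Reasoning
    e₁ e₂ : ℕ
    e₁ = 2 * 𝟙 (1 ≤? f b)
    e₂ = 2 * 𝟙 (f b ≟ 2)

  ∑∑label≤ : ∑∑ label ≤ 2 * ∣ D ∣ * weight H f
  ∑∑label≤ = begin
    ∑∑ label
      ≤⟨ ∑-mono (λ a → ∑-mono (λ b → m⊓n≤n 2 (sum (λ x → K x a b)))) ⟩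
    sum (λ a → sum (λ b → sum (λ x → K x a b)))
      ≡⟨ ∑-comm (λ a b → sum (λ x → K x a b)) ⟩
    sum (λ b → sum (λ a → sum (λ x → K x a b)))
      ≡⟨ sum-cong-≗ (λ b → ∑-comm (λ a x → K x a b)) ⟩
    sum (λ b → sum (λ x → sum (λ a → K x a b)))
      ≡⟨ sum-cong-≗ (λ b → sum-cong-≗ λ x → *-distribˡ-sum (𝟙 (x ∈? D)) (flip (contribution x) b)) ⟨
    sum (λ b → sum (λ x → 𝟙 (x ∈? D) * sum (λ a → contribution x a b)))
      ≤⟨ ∑-mono (λ b → ∑-mono (λ x → *-monoʳ-≤ (𝟙 (x ∈? D)) (contribution-cost x b))) ⟩
    sum (λ b → sum (λ x → 𝟙 (x ∈? D) * (2 * f b)))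
      ≡⟨ sum-cong-≗ (λ b → ∑-𝟙∈-* D (2 * f b)) ⟩
    sum (λ b → ∣ D ∣ * (2 * f b))
      ≡⟨ *-distribˡ-sum ∣ D ∣ (λ b → 2 * f b) ⟨
    ∣ D ∣ * sum (λ b → 2 * f b)
      ≡⟨ cong (∣ D ∣ *_) (*-distribˡ-sum 2 f) ⟨
    ∣ D ∣ * (2 * sum f)
      ≡⟨ *-assoc ∣ D ∣ 2 (sum f) ⟨
    ∣ D ∣ * 2 * sum f
      ≡⟨ cong₂ _*_ (*-comm 2 ∣ D ∣) (weight≡sum H f) ⟨
    2 * ∣ D ∣ * weight H f ∎
    where
    open ≤-Reasoning
    K : Fin (n G) → Fin (n G) → Fin (n H) → ℕ
    K x a b = 𝟙 (x ∈? D) * contribution x a b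

∃productRDF≤2*γ*γtR : ∀ G H {γ γt} → NoIsolated G →
  IsDominationNumber G γ → IsTotalRomanDominationNumber H γt →
  ∃ λ h → IsProductRDF G H h × ∑∑ h ≤ 2 * γ * γt
∃productRDF≤2*γ*γtR G H noIsolated ((D , dominating , ∣D∣≡γ) , _) ((f , trdf , wf≡γt) , _) =
  label , label-isProductRDF , subst₂ (λ d w → ∑∑ label ≤ 2 * d * w) ∣D∣≡γ wf≡γt ∑∑label≤
  where open DominationLabel {G} {H} noIsolated {D} dominating {f} trdf

theorem2p2 : (G H : Graph) → NoIsolated G → NoIsolated H →
  ∀ {ρG ρH γG γH γRG γRH γtRG γtRH γRGH : ℕ} →
  IsPackingNumber G ρG → IsPackingNumber H ρH →
  IsDominationNumber G γG → IsDominationNumber H γH →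
  IsRomanDominationNumber G γRG → IsRomanDominationNumber H γRH →
  IsTotalRomanDominationNumber G γtRG → IsTotalRomanDominationNumber H γtRH →
  IsRomanDominationNumber (G ⊠ H) γRGH →
  ((ρG * γRH) ⊔ (ρH * γRG) ≤ γRGH)
    × (γRGH ≤ (2 * γG * γtRH) ⊓ (2 * γH * γtRG))
theorem2p2 G H noG noH PG PH DG DH RG RH TG TH RGH =
  let (h , h-rdf , ∑∑h≡γ) = γR⊠-attained G H RGH
      (h₁ , h₁-rdf , ∑∑h₁≤) = ∃productRDF≤2*γ*γtR G H noG DG TH
      (h₂ , h₂-rdf , ∑∑h₂≤) = ∃productRDF≤2*γ*γtR H G noH DH TG
  in ⊔-lub (subst (_ ≤_) ∑∑h≡γ (ρ*γR≤∑∑ h-rdf PG RH))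
           (subst (_ ≤_) (trans (∑∑-flip h) ∑∑h≡γ) (ρ*γR≤∑∑ (IsProductRDF-flip h-rdf) PH RG)) ,
     ⊓-glb (≤-trans (γR⊠≤∑∑ G H RGH h₁-rdf) ∑∑h₁≤)
           (≤-trans (γR⊠≤∑∑ G H RGH (IsProductRDF-flip h₂-rdf))
                    (subst (_≤ _) (sym (∑∑-flip h₂)) ∑∑h₂≤))
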